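{- Let $m\geq 3$ and $\ell\in\{0,1,2\}$. The pseudo-Cartesian product $C_m\Box_\ell C_3$ is $3$-spanning cyclable if and only if $m\geq 4$ and $\ell=0$.
   Context: The pseudo-Cartesian product $C_m\Box_\ell C_n$ has vertices $u_{i,j}$, $0\le i\le m-1$, $j\in\mathbb{Z}_n$, and edges $[u_{i,j},u_{i,j+1}]$ for all $i,j$, $[u_{i,j},u_{i+1,j}]$ for $0\le i\le m-2$, and $[u_{m-1,j},u_{0,j+\ell}]$ for all $j$ (second indices mod $n$). A 2-factor of a graph is a spanning subgraph in which every vertex has valency 2; it separates a set $A$ of $k$ vertices if it consists of exactly $k$ cycles and $A$ meets the vertex set of each cycle in exactly one vertex. A graph $X$ is $k$-spanning cyclable if for every $A\subseteq V(X)$ with $|A|=k$ there is a 2-factor of $X$ separating $A$. -}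

module Defs where

open import Level using (0ℓ) renaming (suc to lsuc)
open import Data.Nat using (ℕ; zero; suc; _+_; _%_; NonZero)
open import Data.Fin using (Fin; toℕ)
open import Data.Product using (_×_; Σ; ∃; ∃-syntax; _,_)
open import Data.Sum using (_⊎_)
open import Relation.Binary.PropositionalEquality using (_≡_; _≢_)
open import Relation.Binary.Construct.Closure.ReflexiveTransitive using (Star)
open import Function.Definitions using (Injective)

Vertex : ℕ → ℕ → Set
Vertex m n = Fin m × Fin n

data Edge (m ℓ n : ℕ) .{{_ : NonZero n}} : Vertex m n → Vertex m n → Set where
  horiz : ∀ (i : Fin m) (j j' : Fin n) → toℕ j' ≡ suc (toℕ j) % n →
          Edge m ℓ n (i , j) (i , j')
  vert  : ∀ (i i' : Fin m) (j : Fin n) → toℕ i' ≡ suc (toℕ i) →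
          Edge m ℓ n (i , j) (i' , j)
  wrap  : ∀ (i i' : Fin m) (j j' : Fin n) → suc (toℕ i) ≡ m → toℕ i' ≡ 0 →
          toℕ j' ≡ (toℕ j + ℓ) % n →
          Edge m ℓ n (i , j) (i' , j')

Adj : (m ℓ n : ℕ) .{{_ : NonZero n}} → Vertex m n → Vertex m n → Set
Adj m ℓ n x y = Edge m ℓ n x y ⊎ Edge m ℓ n y x

record TwoFactor (m ℓ n : ℕ) .{{_ : NonZero n}} : Set₁ where
  field
    F     : Vertex m n → Vertex m n → Set
    F-sym : ∀ {x y} → F x y → F y x
    F-sub : ∀ {x y} → F x y → Adj m ℓ n x y
    deg2  : ∀ v → ∃[ x ] ∃[ y ] (x ≢ y × F v x × F v y ×
                     (∀ z → F v z → z ≡ x ⊎ z ≡ y))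

-- A 2-factor separates the k-set A = {A 0, …, A (k-1)} (A injective) if it
-- has exactly k cycles, each meeting A in exactly one vertex.  Cycles of a
-- 2-factor are its connected components (Star = reachability along F):
-- every vertex lies in the cycle of some vertex of A, and distinct vertices
-- of A lie in distinct cycles.
Separates : ∀ {m ℓ n} .{{_ : NonZero n}} (k : ℕ) → TwoFactor m ℓ n →
            (Fin k → Vertex m n) → Set
Separates k T A =
  (∀ v → ∃[ i ] Star (TwoFactor.F T) (A i) v) ×
  (∀ i i' → Star (TwoFactor.F T) (A i) (A i') → i ≡ i')

SpanningCyclable : (k m ℓ n : ℕ) .{{_ : NonZero n}} → Set₁
SpanningCyclable k m ℓ n =
  ∀ (A : Fin k → Vertex m n) → Injective _≡_ _≡_ A →
  Σ (TwoFactor m ℓ n) (λ T → Separates k T A)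

module Submission where

-- If ℓ ≢ 0 (mod 3), let A be row 0. Climbing row by row, every u_{i,j} lies on
-- the cycle through u_{0,j}: a horizontal edge would join two of these cycles, so each vertex
-- continues straight up, and at the top the wrap edge joins the cycle of u_{0,0} to that of
-- u_{0,ℓ}. For m = 3 and ℓ = 0, separating {u_{0,0}, u_{0,1}, u_{1,0}} forces the edges at
-- u_{0,0} and u_{1,0}, after which u_{0,1} has a single admissible neighbour.
--
-- The graph is the torus C_m × C_3, whose row and column rotations
-- are automorphisms, so A may be normalised. If A meets all three columns, the columns are the
-- cycles. If its rows are distinct, the rows are cut into three bands starting at those rows,
-- each band carrying one Hamiltonian cycle. Otherwise two vertices of A share a column and the
-- third shares a row with one of them: the third vertex's column is one cycle, and the other two
-- columns are cut into a 2 × 2 block and a 2 × (m - 2) block, which needs m ≥ 4. Each 2-factor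
-- is given row by row by tiles, and its cycles are told apart by a class function constant
-- along its edges.

open import Defs
open import Data.Nat using (ℕ; _≤_)
open import Data.Product using (_×_)
open import Relation.Binary.PropositionalEquality using (_≡_)
open import Function.Bundles using (_⇔_)

open import Data.Bool using (Bool; true; false; not; T)
open import Data.Empty using (⊥; ⊥-elim)
open import Data.Unit using (⊤; tt)
open import Data.Nat as ℕ using (zero; suc; _+_; _∸_; _%_; _<_; z≤n; s≤s; NonZero)
open import Data.Nat.Properties
  using (suc-injective; ≤-trans; ≤-pred; ≤-reflexive; <-irrefl; <⇒≢; <⇒≤; ≤∧≢⇒<; <-cmp; n≤1+n;
         n<1+n; m<n⇒m<1+n; 1+n≢n; +-suc; +-identityʳ; m≤n⇒∃[o]m+o≡n; m+[n∸m]≡n; +-cancelˡ-≤)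
open import Data.Nat.DivMod using (n%n≡0; m<n⇒m%n≡m; %-distribˡ-+; m%n%n≡m%n)
open import Data.Nat.GeneralisedArithmetic using (iterate)
open import Data.Nat.Induction using (<-wellFounded)
open import Induction.WellFounded using (Acc; acc)
open import Data.Fin using (Fin; zero; suc; toℕ; fromℕ; inject₁; lower₁; punchOut)
open import Data.Fin.Properties
  using (toℕ-injective; toℕ<n; toℕ-fromℕ; toℕ-inject₁; toℕ-inject₁-≢; toℕ-lower₁;
         inject₁-lower₁; lower₁-inject₁′; any?; punchOut-injective; injective⇒≤)
  renaming (_≟_ to _≟ᶠ_)
open import Data.Fin.Patterns using (0F; 1F; 2F)
open import Data.Fin.Permutation using (Permutation′; transpose; _⟨$⟩ʳ_; _⟨$⟩ˡ_; inverseˡ; inverseʳ)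
open import Data.Vec using (Vec; _∷_; []; lookup; map; tabulate; replicate)
open import Data.Vec.Properties
  using (lookup-map; lookup∘tabulate; lookup-replicate; map-replicate; tabulate-cong; tabulate∘lookup)
open import Data.Product as Product using (Σ; ∃-syntax; _,_; proj₁; proj₂)
open import Data.Product.Properties using (≡-dec)
open import Data.Sum as Sum using (_⊎_; inj₁; inj₂)
open import Function using (_∘_)
open import Function.Definitions using (Injective)
open import Function.Bundles using (mk⇔)
open import Relation.Nullary using (¬_; yes; no; contradiction)
open import Relation.Nullary.Decidable using (isYes; _⊎-dec_; toWitness; fromWitness)
open import Relation.Binary.Definitions using (DecidableEquality; tri<; tri≈; tri>)
open import Relation.Binary.PropositionalEquality
  using (_≢_; refl; sym; trans; cong; cong₂; subst; subst₂; module ≡-Reasoning)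
open import Relation.Binary.Construct.Closure.ReflexiveTransitive
  using (Star; ε; _◅_; _◅◅_; reverse; gmap)

private variable
  A : Set
  n : ℕ

csuc : Fin (suc n) → Fin (suc n)
csuc {n} i with n ℕ.≟ toℕ i
... | yes _  = zero
... | no n≢i = suc (lower₁ i n≢i)

cpred : Fin (suc n) → Fin (suc n)
cpred zero    = fromℕ _
cpred (suc i) = inject₁ i

csuc-view : (i : Fin (suc n)) →
            (toℕ i < n × toℕ (csuc i) ≡ suc (toℕ i)) ⊎ (toℕ i ≡ n × csuc i ≡ zero)
csuc-view {n} i with n ℕ.≟ toℕ i
... | yes n≡i = inj₂ (sym n≡i , refl)
... | no n≢i  = inj₁ (≤∧≢⇒< (≤-pred (toℕ<n i)) (n≢i ∘ sym) , cong suc (toℕ-lower₁ i n≢i))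

cpred-csuc : (i : Fin (suc n)) → cpred (csuc i) ≡ i
cpred-csuc {n} i with n ℕ.≟ toℕ i
... | yes n≡i = toℕ-injective (trans (toℕ-fromℕ n) n≡i)
... | no n≢i  = inject₁-lower₁ i n≢i

csuc-cpred : (i : Fin (suc n)) → csuc (cpred i) ≡ i
csuc-cpred {n} zero with n ℕ.≟ toℕ (fromℕ n)
... | yes _  = refl
... | no n≢n = contradiction (sym (toℕ-fromℕ n)) n≢n
csuc-cpred {suc n} (suc i) with suc n ℕ.≟ toℕ (inject₁ i)
... | yes n≡i = contradiction n≡i (toℕ-inject₁-≢ i)
... | no n≢i  = cong suc (lower₁-inject₁′ i n≢i)

csuc-injective : Injective _≡_ _≡_ (csuc {n})
csuc-injective {x = i} {j} eq = trans (sym (cpred-csuc i)) (trans (cong cpred eq) (cpred-csuc j))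

cpred-injective : Injective _≡_ _≡_ (cpred {n})
cpred-injective {x = i} {j} eq = trans (sym (csuc-cpred i)) (trans (cong csuc eq) (csuc-cpred j))

toℕ-csuc : (i : Fin (suc n)) → toℕ (csuc i) ≡ suc (toℕ i) % suc n
toℕ-csuc {n} i with csuc-view i
... | inj₁ (i<n , i+1) = trans i+1 (sym (m<n⇒m%n≡m (s≤s i<n)))
... | inj₂ (i≡n , i+1) =
  trans (cong toℕ i+1) (trans (sym (n%n≡0 (suc n))) (cong (λ x → suc x % suc n) (sym i≡n)))

csuc≢id : 1 ≤ n → (i : Fin (suc n)) → csuc i ≢ i
csuc≢id 1≤n i eq with csuc-view i
... | inj₁ (_ , i+1)   = 1+n≢n (trans (sym i+1) (cong toℕ eq))
... | inj₂ (i≡n , i+1) = <⇒≢ 1≤n (trans (cong toℕ (trans (sym i+1) eq)) i≡n)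

csuc²≢id : 2 ≤ n → (i : Fin (suc n)) → csuc (csuc i) ≢ i
csuc²≢id 2≤n i eq with csuc-view i | csuc-view (csuc i)
... | inj₁ (_ , i+1) | inj₁ (_ , i+2) =
  <⇒≢ (m<n⇒m<1+n (n<1+n (toℕ i))) (trans (cong toℕ (sym eq)) (trans i+2 (cong suc i+1)))
... | inj₁ (_ , i+1) | inj₂ (i+1≡n , i+2) =
  <⇒≢ 2≤n (trans (cong suc (cong toℕ (trans (sym i+2) eq))) (trans (sym i+1) i+1≡n))
... | inj₂ (i≡n , i+1) | inj₁ (_ , i+2) =
  <⇒≢ 2≤n (trans (sym (trans (cong toℕ (sym eq)) (trans i+2 (cong (suc ∘ toℕ) i+1)))) i≡n)
... | inj₂ (_ , i+1) | inj₂ (i+1≡n , _) =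
  <⇒≢ (<⇒≤ 2≤n) (trans (cong toℕ (sym i+1)) i+1≡n)

csuc≢cpred : 2 ≤ n → (i : Fin (suc n)) → csuc i ≢ cpred i
csuc≢cpred 2≤n i eq = csuc²≢id 2≤n i (trans (cong csuc eq) (csuc-cpred i))

iterate-injective : {f : A → A} → Injective _≡_ _≡_ f →
                    ∀ t → Injective _≡_ _≡_ (λ x → iterate f x t)
iterate-injective f-inj zero    eq = eq
iterate-injective f-inj (suc t) eq = f-inj (iterate-injective f-inj t eq)

iterate-cpred-toℕ : (i : Fin (suc n)) → iterate cpred i (toℕ i) ≡ zero
iterate-cpred-toℕ i = go (toℕ i) i refl
  where
  go : ∀ t (i : Fin (suc n)) → toℕ i ≡ t → iterate cpred i t ≡ zero
  go zero    zero    _  = refl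
  go (suc t) (suc i) eq = go t (inject₁ i) (trans (toℕ-inject₁ i) (suc-injective eq))

nonzero-toℕ : {i : Fin (suc n)} → i ≢ 0F → 0 < toℕ i
nonzero-toℕ {i = 0F}    i≢0 = contradiction refl i≢0
nonzero-toℕ {i = suc _} _   = s≤s z≤n

injective₃ : {f : Fin 3 → A} → f 0F ≢ f 1F → f 0F ≢ f 2F → f 1F ≢ f 2F → Injective _≡_ _≡_ f
injective₃ f01 f02 f12 {0F} {0F} _ = refl
injective₃ f01 f02 f12 {0F} {1F} e = contradiction e f01
injective₃ f01 f02 f12 {0F} {2F} e = contradiction e f02
injective₃ f01 f02 f12 {1F} {0F} e = contradiction (sym e) f01
injective₃ f01 f02 f12 {1F} {1F} _ = refl
injective₃ f01 f02 f12 {1F} {2F} e = contradiction e f12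
injective₃ f01 f02 f12 {2F} {0F} e = contradiction (sym e) f02
injective₃ f01 f02 f12 {2F} {1F} e = contradiction (sym e) f12
injective₃ f01 f02 f12 {2F} {2F} _ = refl

injective⇒surjective : {f : Fin n → Fin n} → Injective _≡_ _≡_ f → ∀ y → ∃[ x ] f x ≡ y
injective⇒surjective {suc n} {f} f-inj y with any? (λ x → f x ≟ᶠ y)
... | yes hit  = hit
... | no  miss = contradiction (injective⇒≤ g-inj) (<-irrefl refl)
  where
  y≢f : ∀ x → y ≢ f x
  y≢f x y≡fx = miss (x , sym y≡fx)
  g : Fin (suc n) → Fin n
  g x = punchOut (y≢f x)
  g-inj : Injective _≡_ _≡_ g
  g-inj {x} {x′} eq = f-inj (punchOut-injective (y≢f x) (y≢f x′) eq)

permute-injective : ∀ {k} {f : Fin k → A} (π : Permutation′ k) →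
                    Injective _≡_ _≡_ f → Injective _≡_ _≡_ (f ∘ (π ⟨$⟩ʳ_))
permute-injective π f-inj eq =
  trans (sym (inverseˡ π)) (trans (cong (π ⟨$⟩ˡ_) (f-inj eq)) (inverseˡ π))

descend : {R : A → A → Set} (P : A → Set) (μ : A → ℕ) (r : A) →
          (∀ x → P x → Star R r x ⊎ ∃[ y ] (P y × μ y < μ x × Star R y x)) →
          ∀ x → P x → Star R r x
descend {R = R} P μ r step x px = go x px (<-wellFounded (μ x))
  where
  go : ∀ x → P x → Acc _<_ (μ x) → Star R r x
  go x px (acc rs) with step x px
  ... | inj₁ path                    = path
  ... | inj₂ (y , py , μy<μx , path) = go y py (rs μy<μx) ◅◅ path

-- Separability and symmetry

Separable : ∀ {m n k} .{{_ : NonZero n}} → ℕ → (Fin k → Vertex m n) → Set₁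
Separable {m} {n} {k} ℓ A = Σ (TwoFactor m ℓ n) λ T → Separates k T A

module _ {m ℓ n : ℕ} .{{_ : NonZero n}} where

  separates-by-classes :
    ∀ {k} {A : Fin k → Vertex m n} (T : TwoFactor m ℓ n) {C : Set} (class : Vertex m n → C) →
    (∀ {v w} → TwoFactor.F T v w → class v ≡ class w) →
    (root : C → Vertex m n) → (∀ v → Star (TwoFactor.F T) (root (class v)) v) →
    (∀ v → ∃[ i ] class (A i) ≡ class v) → Injective _≡_ _≡_ (class ∘ A) →
    Separates k T A
  separates-by-classes {A = A} T class invariant root reach cover distinct = covered , apart
    where
    open TwoFactor T
    covered : ∀ v → ∃[ i ] Star F (A i) v
    covered v with cover v
    ... | i , same = i , reverse F-sym (reach (A i)) ◅◅ subst (λ c → Star F (root c) v) (sym same) (reach v)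
    invariant* : ∀ {v w} → Star F v w → class v ≡ class w
    invariant* ε        = refl
    invariant* (f ◅ fs) = trans (invariant f) (invariant* fs)
    apart : ∀ i i′ → Star F (A i) (A i′) → i ≡ i′
    apart i i′ path = distinct (invariant* path)

  separable-cong : ∀ {k} {A B : Fin k → Vertex m n} → (∀ i → A i ≡ B i) →
                   Separable ℓ A → Separable ℓ B
  separable-cong {A = A} {B} A≗B (T , covered , apart) = T , covered′ , apart′
    where
    open TwoFactor T
    covered′ : ∀ v → ∃[ i ] Star F (B i) v
    covered′ v with covered v
    ... | i , path = i , subst (λ a → Star F a v) (A≗B i) path
    apart′ : ∀ i i′ → Star F (B i) (B i′) → i ≡ i′
    apart′ i i′ path = apart i i′ (subst₂ (Star F) (sym (A≗B i)) (sym (A≗B i′)) path)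

  separable-permute : ∀ {k} {A : Fin k → Vertex m n} (π : Permutation′ k) →
                      Separable ℓ (A ∘ (π ⟨$⟩ʳ_)) → Separable ℓ A
  separable-permute {A = A} π (T , covered , apart) = T , covered′ , apart′
    where
    open TwoFactor T
    covered′ : ∀ v → ∃[ i ] Star F (A i) v
    covered′ v with covered v
    ... | i , path = π ⟨$⟩ʳ i , path
    A∘π∘π⁻¹ : ∀ i → A i ≡ A (π ⟨$⟩ʳ (π ⟨$⟩ˡ i))
    A∘π∘π⁻¹ i = cong A (sym (inverseʳ π))
    apart′ : ∀ i i′ → Star F (A i) (A i′) → i ≡ i′
    apart′ i i′ path = begin
      i                   ≡⟨ inverseʳ π ⟨
      π ⟨$⟩ʳ (π ⟨$⟩ˡ i)  ≡⟨ cong (π ⟨$⟩ʳ_) (apart _ _ (subst₂ (Star F) (A∘π∘π⁻¹ i) (A∘π∘π⁻¹ i′) path)) ⟩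
      π ⟨$⟩ʳ (π ⟨$⟩ˡ i′) ≡⟨ inverseʳ π ⟩
      i′                  ∎
      where open ≡-Reasoning

  record Automorphism : Set where
    field
      to from : Vertex m n → Vertex m n
      to-from : ∀ v → to (from v) ≡ v
      from-to : ∀ v → from (to v) ≡ v
      to-adj  : ∀ {v w} → Adj m ℓ n v w → Adj m ℓ n (to v) (to w)

  module _ (φ : Automorphism) where
    open Automorphism φ

    separable-transport : ∀ {k} {A : Fin k → Vertex m n} → Separable ℓ (from ∘ A) → Separable ℓ A
    separable-transport {k} {A} (T , covered , apart) = T′ , covered′ , apart′
      where
      open TwoFactor T
      F′ : Vertex m n → Vertex m n → Set
      F′ v w = F (from v) (from w)
      into : ∀ {v w} → F (from v) w → F′ v (to w)
      into {v} {w} = subst (F (from v)) (sym (from-to w))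
      to-F : ∀ {v w} → F v w → F′ (to v) (to w)
      to-F {v} {w} = subst₂ F (sym (from-to v)) (sym (from-to w))
      to-injective : ∀ {x y} → to x ≡ to y → x ≡ y
      to-injective {x} {y} e = trans (sym (from-to x)) (trans (cong from e) (from-to y))
      from≡⇒≡to : ∀ {z x} → from z ≡ x → z ≡ to x
      from≡⇒≡to {z} e = trans (sym (to-from z)) (cong to e)
      neighbours : ∀ v → ∃[ x ] ∃[ y ] (x ≢ y × F′ v x × F′ v y ×
                                        (∀ z → F′ v z → z ≡ x ⊎ z ≡ y))
      neighbours v with deg2 (from v)
      ... | x , y , x≢y , fx , fy , only =
        to x , to y , x≢y ∘ to-injective , into fx , into fy ,
        λ z f → Sum.map from≡⇒≡to from≡⇒≡to (only (from z) f)
      T′ : TwoFactor m ℓ n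
      T′ = record
        { F     = F′
        ; F-sym = F-sym
        ; F-sub = λ {v} {w} f → subst₂ (Adj m ℓ n) (to-from v) (to-from w) (to-adj (F-sub f))
        ; deg2  = neighbours
        }
      covered′ : ∀ v → ∃[ i ] Star F′ (A i) v
      covered′ v with covered (from v)
      ... | i , path = i , subst₂ (Star F′) (to-from (A i)) (to-from v) (gmap to to-F path)
      apart′ : ∀ i i′ → Star F′ (A i) (A i′) → i ≡ i′
      apart′ i i′ path = apart i i′ (gmap from (λ f → f) path)

    separable-transport-iterate : ∀ {k} {A : Fin k → Vertex m n} t →
                                  Separable ℓ (λ i → iterate from (A i) t) → Separable ℓ A
    separable-transport-iterate zero    S = S
    separable-transport-iterate (suc t) S = separable-transport (separable-transport-iterate t S)

-- Moves on the torus

data Axis : Set where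
  vertical horizontal : Axis

data Sign : Set where
  forward backward : Sign

invert : Sign → Sign
invert forward  = backward
invert backward = forward

Dir : Set
Dir = Axis × Sign

pattern U = vertical   , forward
pattern D = vertical   , backward
pattern R = horizontal , forward
pattern L = horizontal , backward

_≟ᵃ_ : DecidableEquality Axis
vertical   ≟ᵃ vertical   = yes refl
vertical   ≟ᵃ horizontal = no λ ()
horizontal ≟ᵃ vertical   = no λ ()
horizontal ≟ᵃ horizontal = yes refl

_≟ˢ_ : DecidableEquality Sign
forward  ≟ˢ forward  = yes refl
forward  ≟ˢ backward = no λ ()
backward ≟ˢ forward  = no λ ()
backward ≟ˢ backward = yes refl

_≟ᵈ_ : DecidableEquality Dir
_≟ᵈ_ = ≡-dec _≟ᵃ_ _≟ˢ_

opposite : Dir → Dir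
opposite = Product.map₂ invert

step : Sign → Fin (suc n) → Fin (suc n)
step forward  = csuc
step backward = cpred

step-invert : ∀ s (i : Fin (suc n)) → step (invert s) (step s i) ≡ i
step-invert forward  = cpred-csuc
step-invert backward = csuc-cpred

step-csuc : ∀ s (i : Fin (suc n)) → step s (csuc i) ≡ csuc (step s i)
step-csuc forward  i = refl
step-csuc backward i = trans (cpred-csuc i) (sym (csuc-cpred i))

step≢id : 1 ≤ n → ∀ s (i : Fin (suc n)) → step s i ≢ i
step≢id 1≤n forward  i    = csuc≢id 1≤n i
step≢id 1≤n backward i eq = csuc≢id 1≤n i (trans (cong csuc (sym eq)) (csuc-cpred i))

-- M and N are one less than the numbers of rows and columns.
Torus : ℕ → ℕ → Set
Torus M N = Vertex (suc M) (suc N)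

module _ {M N : ℕ} where

  move : Dir → Torus M N → Torus M N
  move (vertical   , s) (i , j) = step s i , j
  move (horizontal , s) (i , j) = i , step s j

  move-opposite : ∀ d v → move (opposite d) (move d v) ≡ v
  move-opposite (vertical   , s) (i , j) = cong (_, j) (step-invert s i)
  move-opposite (horizontal , s) (i , j) = cong (i ,_) (step-invert s j)

  move-injective : 2 ≤ M → 2 ≤ N → ∀ {d d′} v → d ≢ d′ → move d v ≢ move d′ v
  move-injective 2≤M 2≤N {a , s} {a′ , s′} (i , j) d≢d′ eq with a | a′ | s | s′
  ... | vertical   | vertical   | forward  | forward  = d≢d′ refl
  ... | vertical   | vertical   | forward  | backward = csuc≢cpred 2≤M i (cong proj₁ eq)
  ... | vertical   | vertical   | backward | forward  = csuc≢cpred 2≤M i (sym (cong proj₁ eq))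
  ... | vertical   | vertical   | backward | backward = d≢d′ refl
  ... | vertical   | horizontal | _        | t        = step≢id (<⇒≤ 2≤N) t j (sym (cong proj₂ eq))
  ... | horizontal | vertical   | t        | _        = step≢id (<⇒≤ 2≤N) t j (cong proj₂ eq)
  ... | horizontal | horizontal | forward  | forward  = d≢d′ refl
  ... | horizontal | horizontal | forward  | backward = csuc≢cpred 2≤N j (cong proj₂ eq)
  ... | horizontal | horizontal | backward | forward  = csuc≢cpred 2≤N j (sym (cong proj₂ eq))
  ... | horizontal | horizontal | backward | backward = d≢d′ refl

  private
    j≡j+0 : (j : Fin (suc N)) → toℕ j ≡ (toℕ j + 0) % suc N
    j≡j+0 j = sym (trans (cong (_% suc N) (+-identityʳ (toℕ j))) (m<n⇒m%n≡m (toℕ<n j)))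

  adj-forward : ∀ a (v : Torus M N) → Adj (suc M) 0 (suc N) v (move (a , forward) v)
  adj-forward vertical (i , j) with csuc-view i
  ... | inj₁ (_ , i+1)   = inj₁ (vert i (csuc i) j i+1)
  ... | inj₂ (i≡M , i+1) = inj₁ (wrap i (csuc i) j j (cong suc i≡M) (cong toℕ i+1) (j≡j+0 j))
  adj-forward horizontal (i , j) = inj₁ (horiz i j (csuc j) (toℕ-csuc j))

  adj-move : ∀ d (v : Torus M N) → Adj (suc M) 0 (suc N) v (move d v)
  adj-move (a , forward)  v = adj-forward a v
  adj-move (a , backward) v =
    Sum.swap (subst (Adj _ 0 _ (move (a , backward) v)) (move-opposite (a , backward) v)
                    (adj-forward a (move (a , backward) v)))

  edge⇒move : {v w : Torus M N} → Edge (suc M) 0 (suc N) v w → ∃[ d ] w ≡ move d v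
  edge⇒move (horiz i j j′ j′≡) = R , cong (i ,_) (toℕ-injective (trans j′≡ (sym (toℕ-csuc j))))
  edge⇒move (vert i i′ j i′≡) with csuc-view i
  ... | inj₁ (_ , i+1)  = U , cong (_, j) (toℕ-injective (trans i′≡ (sym i+1)))
  ... | inj₂ (i≡M , _) =
    contradiction (subst (_< suc M) (trans i′≡ (cong suc i≡M)) (toℕ<n i′)) (<-irrefl refl)
  edge⇒move (wrap i i′ j j′ last i′≡0 j′≡) with csuc-view i
  ... | inj₁ (i<M , _) = contradiction (subst (_< M) (suc-injective last) i<M) (<-irrefl refl)
  ... | inj₂ (_ , i+1)  = U , cong₂ _,_ (toℕ-injective (trans i′≡0 (sym (cong toℕ i+1))))
                                       (toℕ-injective (trans j′≡ (sym (j≡j+0 j))))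

  adj⇒move : {v w : Torus M N} → Adj (suc M) 0 (suc N) v w → ∃[ d ] w ≡ move d v
  adj⇒move (inj₁ e) = edge⇒move e
  adj⇒move (inj₂ e) with edge⇒move e
  ... | d , refl = opposite d , sym (move-opposite d _)

  translation : (to from : Torus M N → Torus M N) →
                (∀ v → to (from v) ≡ v) → (∀ v → from (to v) ≡ v) →
                (∀ d v → to (move d v) ≡ move d (to v)) → Automorphism {suc M} {0} {suc N}
  translation to from to-from from-to commutes = record
    { to = to ; from = from ; to-from = to-from ; from-to = from-to ; to-adj = to-adj }
    where
    to-adj : ∀ {v w} → Adj (suc M) 0 (suc N) v w → Adj (suc M) 0 (suc N) (to v) (to w)
    to-adj {v} a with adj⇒move a
    ... | d , refl = subst (Adj _ 0 _ (to v)) (sym (commutes d v)) (adj-move d (to v))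

  rowRotation : Automorphism {suc M} {0} {suc N}
  rowRotation = translation (Product.map₁ csuc) (Product.map₁ cpred)
    (λ (i , j) → cong (_, j) (csuc-cpred i)) (λ (i , j) → cong (_, j) (cpred-csuc i)) commutes
    where
    commutes : ∀ d v → Product.map₁ csuc (move d v) ≡ move d (Product.map₁ csuc v)
    commutes (vertical   , s) (i , j) = cong (_, j) (sym (step-csuc s i))
    commutes (horizontal , s) (i , j) = refl

  columnRotation : Automorphism {suc M} {0} {suc N}
  columnRotation = translation (Product.map₂ csuc) (Product.map₂ cpred)
    (λ (i , j) → cong (i ,_) (csuc-cpred j)) (λ (i , j) → cong (i ,_) (cpred-csuc j)) commutes
    where
    commutes : ∀ d v → Product.map₂ csuc (move d v) ≡ move d (Product.map₂ csuc v)
    commutes (vertical   , s) (i , j) = refl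
    commutes (horizontal , s) (i , j) = cong (i ,_) (sym (step-csuc s j))

  shift : ℕ → ℕ → Torus M N → Torus M N
  shift t₁ t₂ = Product.map (λ i → iterate cpred i t₁) (λ j → iterate cpred j t₂)

  separable-shift : ∀ {k} {A : Fin k → Torus M N} t₁ t₂ →
                    Separable 0 (shift t₁ t₂ ∘ A) → Separable 0 A
  separable-shift {A = A} t₁ t₂ S =
    separable-transport-iterate rowRotation t₁
      (separable-transport-iterate columnRotation t₂ (separable-cong (λ i → sym (rotated (A i))) S))
    where
    rows : ∀ t (v : Torus M N) →
           iterate (Product.map₁ cpred) v t ≡ (iterate cpred (proj₁ v) t , proj₂ v)
    rows zero    v = refl
    rows (suc t) v = rows t (Product.map₁ cpred v)
    columns : ∀ t (v : Torus M N) →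
              iterate (Product.map₂ cpred) v t ≡ (proj₁ v , iterate cpred (proj₂ v) t)
    columns zero    v = refl
    columns (suc t) v = columns t (Product.map₂ cpred v)
    rotated : ∀ v → iterate (Product.map₂ cpred) (iterate (Product.map₁ cpred) v t₁) t₂ ≡
                    shift t₁ t₂ v
    rotated v = trans (cong (λ w → iterate (Product.map₂ cpred) w t₂) (rows t₁ v)) (columns t₂ _)

-- Tilings of the torus

data Tile : Set where
  │ ─ └ ┘ ┌ ┐ : Tile

-- Rows are drawn with the row index increasing upwards, so U leads to the next row.
ends : Tile → Dir × Dir
ends │ = U , D
ends ─ = L , R
ends └ = U , R
ends ┘ = U , L
ends ┌ = D , R
ends ┐ = D , L

ends-distinct : ∀ t → proj₁ (ends t) ≢ proj₂ (ends t)
ends-distinct │ ()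
ends-distinct ─ ()
ends-distinct └ ()
ends-distinct ┘ ()
ends-distinct ┌ ()
ends-distinct ┐ ()

opens : Dir → Tile → Bool
opens d t = isYes (d ≟ᵈ proj₁ (ends t) ⊎-dec d ≟ᵈ proj₂ (ends t))

Row : ℕ → Set
Row = Vec Tile

openings : Dir → Row n → Vec Bool n
openings d = map (opens d)

Stackable : Row n → Row n → Set
Stackable X Y = openings U X ≡ openings D Y

Consistent : Row (suc n) → Set
Consistent X = openings R X ≡ tabulate (λ j → opens L (lookup X (csuc j)))

Supported : Row (suc n) → Fin (suc n) → Set
Supported X j = T (opens D (lookup X j)) ⊎
                ∃[ s ] (T (opens (horizontal , s) (lookup X j)) × T (opens D (lookup X (step s j))))

stackable-at : {X Y : Row n} → Stackable X Y → ∀ j → opens U (lookup X j) ≡ opens D (lookup Y j)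
stackable-at {X = X} {Y} eq j =
  trans (sym (lookup-map j (opens U) X))
        (trans (cong (λ v → lookup v j) eq) (lookup-map j (opens D) Y))

consistent-at : {X : Row (suc n)} → Consistent X →
                ∀ j → opens R (lookup X j) ≡ opens L (lookup X (csuc j))
consistent-at {X = X} eq j =
  trans (sym (lookup-map j (opens R) X))
        (trans (cong (λ v → lookup v j) eq) (lookup∘tabulate (λ j → opens L (lookup X (csuc j))) j))

module TileFactor {M N : ℕ} (2≤M : 2 ≤ M) (2≤N : 2 ≤ N) (τ : Fin (suc M) → Row (suc N))
                  (consistent : ∀ i → Consistent (τ i))
                  (stackable : ∀ i → Stackable (τ i) (τ (csuc i))) where

  tile : Torus M N → Tile
  tile v = lookup (τ (proj₁ v)) (proj₂ v)

  Opens : Dir → Torus M N → Set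
  Opens d v = T (opens d (tile v))

  F : Torus M N → Torus M N → Set
  F v w = ∃[ d ] (Opens d v × w ≡ move d v)

  opens-opposite : ∀ d v → Opens d v → Opens (opposite d) (move d v)
  opens-opposite U (i , j) = subst T (stackable-at (stackable i) j)
  opens-opposite D (i , j) = subst T (sym (trans (stackable-at (stackable (cpred i)) j)
                                                 (cong (λ i′ → opens D (lookup (τ i′) j)) (csuc-cpred i))))
  opens-opposite R (i , j) = subst T (consistent-at (consistent i) j)
  opens-opposite L (i , j) = subst T (sym (trans (consistent-at (consistent i) (cpred j))
                                                 (cong (λ j′ → opens L (lookup (τ i) j′)) (csuc-cpred j))))

  F-sym : ∀ {v w} → F v w → F w v
  F-sym {v} (d , o , refl) = opposite d , opens-opposite d v o , sym (move-opposite d v)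

  along : ∀ d v → Opens d v → F v (move d v)
  along d v o = d , o , refl

  back : ∀ d v → Opens d v → Star F (move d v) v
  back d v o = F-sym (along d v o) ◅ ε

  factor : TwoFactor (suc M) 0 (suc N)
  factor = record
    { F     = F
    ; F-sym = F-sym
    ; F-sub = λ { {v} (d , _ , refl) → adj-move d v }
    ; deg2  = neighbours
    }
    where
    neighbours : ∀ v → ∃[ x ] ∃[ y ] (x ≢ y × F v x × F v y × (∀ z → F v z → z ≡ x ⊎ z ≡ y))
    neighbours v =
      move a v , move b v , move-injective 2≤M 2≤N v (ends-distinct (tile v)) ,
      along a v (fromWitness (inj₁ refl)) , along b v (fromWitness (inj₂ refl)) ,
      λ { z (d , o , refl) → Sum.map (cong (λ d → move d v)) (cong (λ d → move d v)) (toWitness o) }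
      where
      a b : Dir
      a = proj₁ (ends (tile v))
      b = proj₂ (ends (tile v))

  invariant : {C : Set} (class : Torus M N → C) →
              (∀ v → Opens U v → class (move U v) ≡ class v) →
              (∀ v → Opens R v → class (move R v) ≡ class v) →
              ∀ {v w} → F v w → class v ≡ class w
  invariant class up right {v} (U , o , refl) = sym (up v o)
  invariant class up right {v} (R , o , refl) = sym (right v o)
  invariant class up right {v} (D , o , refl) =
    trans (cong class (sym (move-opposite D v))) (up (move D v) (opens-opposite D v o))
  invariant class up right {v} (L , o , refl) =
    trans (cong class (sym (move-opposite L v))) (right (move L v) (opens-opposite L v o))

  supported-path : ∀ {i j} → Supported (τ i) j → ∃[ j′ ] Star F (cpred i , j′) (i , j)
  supported-path {i} {j} (inj₁ o)           = j , back D (i , j) o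
  supported-path {i} {j} (inj₂ (s , h , o)) =
    step s j , back D (i , step s j) o ◅◅ back (horizontal , s) (i , j) h

  pipe-reach : ∀ j → (∀ i → Opens D (i , j)) → ∀ i → Star F (zero , j) (i , j)
  pipe-reach j open-down i = descend InColumn (toℕ ∘ proj₁) (zero , j) descent (i , j) refl
    where
    InColumn : Torus M N → Set
    InColumn v = proj₂ v ≡ j
    descent : ∀ v → InColumn v →
              Star F (zero , j) v ⊎ ∃[ w ] (InColumn w × toℕ (proj₁ w) < toℕ (proj₁ v) × Star F w v)
    descent (zero  , .j) refl = inj₁ ε
    descent (suc i , .j) refl =
      inj₂ ((inject₁ i , j) , refl , s≤s (≤-reflexive (toℕ-inject₁ i)) ,
            back D (suc i , j) (open-down (suc i)))

-- Block layouts

record Place : Set where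
  constructor place
  field
    block depth rest : ℕ

open Place

-- Block k consists of height k + 1 consecutive rows; locate t says that row t is the row
-- number `depth` of block `block`, and that `rest` rows of that block come after it.
module Layout (height : ℕ → ℕ) where

  next : Place → Place
  next (place k d (suc r)) = place k (suc d) r
  next (place k d zero)    = place (suc k) zero (height (suc k))

  next-block : ∀ p → rest p ≢ 0 → block (next p) ≡ block p
  next-block (place k d zero)    r≢0 = contradiction refl r≢0
  next-block (place k d (suc r)) _   = refl

  next-inverse : ∀ {p k d r} → next p ≡ place k (suc d) r → p ≡ place k d (suc r)
  next-inverse {place k d (suc r)} refl = refl

  locate : ℕ → Place
  locate zero    = place 0 0 (height 0)
  locate (suc t) = next (locate t)

  start : ℕ → ℕ
  start zero    = 0
  start (suc k) = start k + suc (height k)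

  locate-spec : ∀ t → let p = locate t in
                t ≡ start (block p) + depth p × depth p + rest p ≡ height (block p)
  locate-spec zero = refl , refl
  locate-spec (suc t) with locate t | locate-spec t
  ... | place k d (suc r) | t≡ , d+r≡ =
    trans (cong suc t≡) (sym (+-suc (start k) d)) , trans (sym (+-suc d r)) d+r≡
  ... | place k d zero    | t≡ , d+0≡ = t+1≡ , refl
    where
    open ≡-Reasoning
    t+1≡ : suc t ≡ start k + suc (height k) + 0
    t+1≡ = begin
      suc t                        ≡⟨ cong suc t≡ ⟩
      suc (start k + d)            ≡⟨ sym (+-suc (start k) d) ⟩
      start k + suc d              ≡⟨ cong (λ x → start k + suc x) (trans (sym (+-identityʳ d)) d+0≡) ⟩
      start k + suc (height k)     ≡⟨ sym (+-identityʳ _) ⟩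
      start k + suc (height k) + 0 ∎

  locate-start : ∀ k d r → d + r ≡ height k → locate (start k + d) ≡ place k d r
  locate-start k (suc d) r d+r≡ = begin
    locate (start k + suc d)    ≡⟨ cong locate (+-suc (start k) d) ⟩
    next (locate (start k + d)) ≡⟨ cong next (locate-start k d (suc r) (trans (+-suc d r) d+r≡)) ⟩
    place k (suc d) r           ∎
    where open ≡-Reasoning
  locate-start zero    zero r r≡ = cong (place 0 0) (sym r≡)
  locate-start (suc k) zero r r≡ = begin
    locate (start k + suc (height k) + 0)
      ≡⟨ cong locate (trans (+-identityʳ _) (+-suc (start k) (height k))) ⟩
    next (locate (start k + height k))
      ≡⟨ cong next (locate-start k (height k) 0 (+-identityʳ _)) ⟩
    place (suc k) 0 (height (suc k))      ≡⟨ cong (place (suc k) 0) (sym r≡) ⟩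
    place (suc k) 0 r                     ∎
    where open ≡-Reasoning

  block-bounded : ∀ last t → t ≤ start last + height last → block (locate t) ≤ last
  block-bounded last zero    _   = z≤n
  block-bounded last (suc t) t<M
    with locate t | locate-spec t | block-bounded last t (≤-trans (n≤1+n t) t<M)
  ... | place k d (suc r) | _         | k≤last = k≤last
  ... | place k d zero    | t≡ , d+0≡ | k≤last = ≤∧≢⇒< k≤last k≢last
    where
    k≢last : k ≢ last
    k≢last refl = <-irrefl (trans t≡ (cong (start k +_) (trans (sym (+-identityʳ d)) d+0≡))) t<M

module BlockFactor {M : ℕ} (2≤M : 2 ≤ M) (height : ℕ → ℕ) (last : ℕ)
                   (M≡ : M ≡ Layout.start height last + height last)
                   (shape : ℕ → ℕ → Row 3)
                   (consistent : ∀ d r → Consistent (shape d r))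
                   (within : ∀ d r → Stackable (shape d (suc r)) (shape (suc d) r))
                   (between : ∀ k → Stackable (shape (height k) 0) (shape 0 (height (suc k))))
                   (wrap : Stackable (shape (height last) 0) (shape 0 (height 0))) where

  open Layout height public

  placeOf : Fin (suc M) → Place
  placeOf i = locate (toℕ i)

  shapeAt : Place → Row 3
  shapeAt p = shape (depth p) (rest p)

  stackable-next : ∀ t → Stackable (shapeAt (locate t)) (shapeAt (locate (suc t)))
  stackable-next t with locate t | locate-spec t
  ... | place k d (suc r) | _        = within d r
  ... | place k d zero    | _ , d+0≡ =
    subst (λ x → Stackable (shape x 0) (shape 0 (height (suc k))))
          (sym (trans (sym (+-identityʳ d)) d+0≡)) (between k)

  placeOf-last : ∀ i → toℕ i ≡ M → placeOf i ≡ place last (height last) 0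
  placeOf-last i i≡M =
    trans (cong locate (trans i≡M M≡)) (locate-start last (height last) 0 (+-identityʳ _))

  stackable : ∀ i → Stackable (shapeAt (placeOf i)) (shapeAt (placeOf (csuc i)))
  stackable i with csuc-view i
  ... | inj₁ (_ , i+1)   =
    subst (λ t → Stackable (shapeAt (placeOf i)) (shapeAt (locate t))) (sym i+1) (stackable-next (toℕ i))
  ... | inj₂ (i≡M , i+1) =
    subst₂ Stackable (cong shapeAt (sym (placeOf-last i i≡M))) (cong (shapeAt ∘ placeOf) (sym i+1)) wrap

  open TileFactor 2≤M (s≤s (s≤s z≤n)) (shapeAt ∘ placeOf) (λ i → consistent _ _) stackable public

  opens-at : ∀ {i k d r} → placeOf i ≡ place k d r →
             ∀ e j → T (opens e (lookup (shape d r) j)) → Opens e (i , j)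
  opens-at eq e j = subst (λ p → T (opens e (lookup (shapeAt p) j))) (sym eq)

  block-up : ∀ i → rest (placeOf i) ≢ 0 → block (placeOf (csuc i)) ≡ block (placeOf i)
  block-up i r≢0 with csuc-view i
  ... | inj₁ (_ , i+1)  = trans (cong (block ∘ locate) i+1) (next-block (placeOf i) r≢0)
  ... | inj₂ (i≡M , _) = contradiction (cong rest (placeOf-last i i≡M)) r≢0

  placeOf-cpred : ∀ i {k d r} → placeOf i ≡ place k (suc d) r →
                  placeOf (cpred i) ≡ place k d (suc r) × toℕ (cpred i) < toℕ i
  placeOf-cpred (suc i) eq =
    trans (cong locate (toℕ-inject₁ i)) (next-inverse eq) , s≤s (≤-reflexive (toℕ-inject₁ i))

  first-row : ∀ i {k r} → placeOf i ≡ place k 0 r → toℕ i ≡ start k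
  first-row i eq = trans (proj₁ (locate-spec (toℕ i)))
                         (trans (cong (λ p → start (block p) + depth p) eq) (+-identityʳ _))

  reach-block : (S : Fin 3 → Set) (k : ℕ) (root : Torus M 2) →
                (∀ {i j r} → S j → placeOf i ≡ place k 0 r → Star F root (i , j)) →
                (∀ {i j d r} → S j → placeOf i ≡ place k (suc d) r →
                               ∃[ j′ ] (S j′ × Star F (cpred i , j′) (i , j))) →
                ∀ {i j} → S j → block (placeOf i) ≡ k → Star F root (i , j)
  reach-block S k root first lower {i} {j} s b = descend P (toℕ ∘ proj₁) root descent (i , j) (s , b)
    where
    P : Torus M 2 → Set
    P (i , j) = S j × block (placeOf i) ≡ k
    descent : ∀ v → P v → Star F root v ⊎ ∃[ w ] (P w × toℕ (proj₁ w) < toℕ (proj₁ v) × Star F w v)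
    descent (i , j) (s , b) with placeOf i in eq
    descent (i , j) (s , refl) | place k zero    r = inj₁ (first s eq)
    descent (i , j) (s , refl) | place k (suc d) r with lower s eq | placeOf-cpred i eq
    ... | j′ , s′ , path | below , lt = inj₂ ((cpred i , j′) , (s′ , cong block below) , lt , path)

-- Column cycles

pipes : ∀ n → Row n
pipes n = replicate n │

pipes-consistent : ∀ n → Consistent (pipes (suc n))
pipes-consistent n = begin
  map (opens R) (pipes (suc n))                              ≡⟨ map-replicate (opens R) │ (suc n) ⟩
  replicate (suc n) false                                    ≡⟨ tabulate∘lookup (replicate (suc n) false) ⟨
  tabulate (lookup (replicate (suc n) false))                ≡⟨ tabulate-cong no-left ⟩
  tabulate (λ j → opens L (lookup (pipes (suc n)) (csuc j))) ∎
  where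
  open ≡-Reasoning
  no-left : ∀ j → lookup (replicate (suc n) false) j ≡ opens L (lookup (pipes (suc n)) (csuc j))
  no-left j = trans (lookup-replicate j false) (sym (cong (opens L) (lookup-replicate (csuc j) │)))

pipes-stackable : ∀ n → Stackable (pipes n) (pipes n)
pipes-stackable n = trans (map-replicate (opens U) │ n) (sym (map-replicate (opens D) │ n))

columns-separable : ∀ {M N} → 2 ≤ M → 2 ≤ N → (A : Fin (suc N) → Torus M N) →
                    Injective _≡_ _≡_ (proj₂ ∘ A) → Separable 0 A
columns-separable {M} {N} 2≤M 2≤N A distinct =
  factor , separates-by-classes factor proj₂ (invariant proj₂ (λ _ _ → refl) no-right) (0F ,_)
                                reach (injective⇒surjective distinct ∘ proj₂) distinct
  where
  open TileFactor 2≤M 2≤N (λ _ → pipes (suc N)) (λ _ → pipes-consistent N)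
                  (λ _ → pipes-stackable (suc N))
  no-right : ∀ v → Opens R v → proj₂ (move R v) ≡ proj₂ v
  no-right (i , j) o = contradiction (subst (T ∘ opens R) (lookup-replicate j │) o) λ ()
  reach : ∀ v → Star F (0F , proj₂ v) v
  reach (i , j) = pipe-reach j (λ _ → subst (T ∘ opens D) (sym (lookup-replicate j │)) tt) i

-- Bands

alternate : ℕ → Bool
alternate zero    = true
alternate (suc d) = not (alternate d)

bandMiddle bandLast : Bool → Row 3
bandMiddle true  = │ ∷ ┌ ∷ ┘ ∷ []
bandMiddle false = │ ∷ └ ∷ ┐ ∷ []
bandLast   true  = ┐ ∷ ┌ ∷ ─ ∷ []
bandLast   false = ┌ ∷ ─ ∷ ┐ ∷ []

-- A band is one cycle: column 0 runs straight through, while columns 1 and 2 zigzag with the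
-- parity of the depth.
bandShape : ℕ → ℕ → Row 3
bandShape zero    zero    = ─ ∷ ─ ∷ ─ ∷ []
bandShape zero    (suc _) = ┘ ∷ └ ∷ ─ ∷ []
bandShape (suc d) zero    = bandLast (alternate d)
bandShape (suc d) (suc _) = bandMiddle (alternate d)

band-consistent : ∀ d r → Consistent (bandShape d r)
band-consistent zero    zero    = refl
band-consistent zero    (suc _) = refl
band-consistent (suc d) zero    with alternate d
... | true  = refl
... | false = refl
band-consistent (suc d) (suc _) with alternate d
... | true  = refl
... | false = refl

band-within : ∀ d r → Stackable (bandShape d (suc r)) (bandShape (suc d) r)
band-within zero    zero    = refl
band-within zero    (suc _) = refl
band-within (suc d) zero    with alternate d
... | true  = refl
... | false = refl
band-within (suc d) (suc _) with alternate d
... | true  = refl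
... | false = refl

band-closed-above : ∀ d → openings U (bandShape d 0) ≡ replicate 3 false
band-closed-above zero    = refl
band-closed-above (suc d) with alternate d
... | true  = refl
... | false = refl

band-closed-below : ∀ r → openings D (bandShape 0 r) ≡ replicate 3 false
band-closed-below zero    = refl
band-closed-below (suc _) = refl

band-between : ∀ d r → Stackable (bandShape d 0) (bandShape 0 r)
band-between d r = trans (band-closed-above d) (sym (band-closed-below r))

band-no-up : ∀ d j → ¬ T (opens U (lookup (bandShape d 0) j))
band-no-up d j = subst T (trans (sym (lookup-map j (opens U) (bandShape d 0)))
                                (trans (cong (λ v → lookup v j) (band-closed-above d))
                                       (lookup-replicate j false)))

band-supported : ∀ d r j → Supported (bandShape (suc d) r) j
band-supported d zero j with alternate d | j
... | true  | 0F = inj₁ tt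
... | true  | 1F = inj₁ tt
... | true  | 2F = inj₂ (backward , tt , tt)
... | false | 0F = inj₁ tt
... | false | 1F = inj₂ (forward , tt , tt)
... | false | 2F = inj₁ tt
band-supported d (suc _) j with alternate d | j
... | true  | 0F = inj₁ tt
... | true  | 1F = inj₁ tt
... | true  | 2F = inj₂ (backward , tt , tt)
... | false | 0F = inj₁ tt
... | false | 1F = inj₂ (forward , tt , tt)
... | false | 2F = inj₁ tt

band-first-left : ∀ r → T (opens L (lookup (bandShape 0 r) 0F)) × T (opens L (lookup (bandShape 0 r) 2F))
band-first-left zero    = tt , tt
band-first-left (suc _) = tt , tt

bandHeight : ℕ → ℕ → ℕ → ℕ → ℕ
bandHeight a b c zero          = a
bandHeight a b c (suc zero)    = b
bandHeight a b c (suc (suc _)) = c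

module _ {M : ℕ} (2≤M : 2 ≤ M) (a b c : ℕ) (M≡ : M ≡ suc a + suc b + c) where

  open BlockFactor 2≤M (bandHeight a b c) 2 M≡ bandShape band-consistent band-within
                   (λ k → band-between (bandHeight a b c k) (bandHeight a b c (suc k))) (band-between c a)

  bands-separable : (A : Fin 3 → Torus M 2) → (∀ i → toℕ (proj₁ (A i)) ≡ start (toℕ i)) → Separable 0 A
  bands-separable A rows =
    factor ,
    separates-by-classes factor class (invariant class up-invariant (λ _ _ → refl)) root reach cover distinct
    where
    class : Torus M 2 → ℕ
    class (i , _) = block (placeOf i)

    up-invariant : ∀ v → Opens U v → class (move U v) ≡ class v
    up-invariant (i , j) o = block-up i λ r≡0 →
      band-no-up d j (subst (λ r → T (opens U (lookup (bandShape d r) j))) r≡0 o)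
      where d = depth (placeOf i)

    index : ℕ → Fin 3
    index zero          = 0F
    index (suc zero)    = 1F
    index (suc (suc _)) = 2F

    toℕ-index : ∀ {k} → k ≤ 2 → toℕ (index k) ≡ k
    toℕ-index z≤n             = refl
    toℕ-index (s≤s z≤n)       = refl
    toℕ-index (s≤s (s≤s z≤n)) = refl

    class-A : ∀ i → class (A i) ≡ toℕ i
    class-A i = cong block (trans (cong locate (trans (rows i) (sym (+-identityʳ _))))
                                  (locate-start (toℕ i) 0 (bandHeight a b c (toℕ i)) refl))

    class≤2 : ∀ v → class v ≤ 2
    class≤2 (i , _) = block-bounded 2 (toℕ i) (subst (toℕ i ≤_) M≡ (≤-pred (toℕ<n i)))

    root : ℕ → Torus M 2
    root k = proj₁ (A (index k)) , 0F

    first-row-path : ∀ {i k r} → placeOf i ≡ place k 0 r → ∀ j → Star F (i , 0F) (i , j)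
    first-row-path {i} {r = r} eq j with band-first-left r | j
    ... | _       | 0F = ε
    ... | l₀ , _  | 2F = along L (i , 0F) (opens-at {i} eq L 0F l₀) ◅ ε
    ... | l₀ , l₂ | 1F =
      along L (i , 0F) (opens-at {i} eq L 0F l₀) ◅ along L (i , 2F) (opens-at {i} eq L 2F l₂) ◅ ε

    reach : ∀ v → Star F (root (class v)) v
    reach (i , j) = reach-block (λ _ → ⊤) k (root k) first lower tt refl
      where
      k = class (i , j)
      first : ∀ {i′ j′ r} → ⊤ → placeOf i′ ≡ place k 0 r → Star F (root k) (i′ , j′)
      first {i′} {j′} _ eq = subst (λ i″ → Star F (i″ , 0F) (i′ , j′)) i′≡ (first-row-path eq j′)
        where
        i′≡ : i′ ≡ proj₁ (A (index k))
        i′≡ = toℕ-injective (trans (first-row i′ eq)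
                                   (sym (trans (rows (index k)) (cong start (toℕ-index (class≤2 (i , j)))))))
      lower : ∀ {i′ j′ d r} → ⊤ → placeOf i′ ≡ place k (suc d) r →
              ∃[ j″ ] (⊤ × Star F (cpred i′ , j″) (i′ , j′))
      lower {i′} {j′} {d} {r} _ eq
        with supported-path (subst (λ p → Supported (shapeAt p) j′) (sym eq) (band-supported d r j′))
      ... | j″ , path = j″ , tt , path

    cover : ∀ v → ∃[ i ] class (A i) ≡ class v
    cover v = index (class v) , trans (class-A _) (toℕ-index (class≤2 v))

    distinct : Injective _≡_ _≡_ (class ∘ A)
    distinct {i} {i′} eq = toℕ-injective (trans (sym (class-A i)) (trans eq (class-A i′)))

-- Ladders

-- Column 0 is a vertical cycle; columns 1 and 2 form a ladder cut into rectangular blocks.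
ladderShape : ℕ → ℕ → Row 3
ladderShape _       zero    = │ ∷ ┌ ∷ ┐ ∷ []
ladderShape zero    (suc _) = │ ∷ └ ∷ ┘ ∷ []
ladderShape (suc _) (suc _) = │ ∷ │ ∷ │ ∷ []

ladder-consistent : ∀ d r → Consistent (ladderShape d r)
ladder-consistent _       zero    = refl
ladder-consistent zero    (suc _) = refl
ladder-consistent (suc _) (suc _) = refl

ladder-within : ∀ d r → Stackable (ladderShape d (suc r)) (ladderShape (suc d) r)
ladder-within zero    zero    = refl
ladder-within zero    (suc _) = refl
ladder-within (suc _) zero    = refl
ladder-within (suc _) (suc _) = refl

ladder-pipe : ∀ d r → lookup (ladderShape d r) 0F ≡ │
ladder-pipe _       zero    = refl
ladder-pipe zero    (suc _) = refl
ladder-pipe (suc _) (suc _) = refl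

ladder-no-right : ∀ d r → ¬ T (opens R (lookup (ladderShape d r) 2F))
ladder-no-right _       zero    ()
ladder-no-right zero    (suc _) ()
ladder-no-right (suc _) (suc _) ()

ladder-first-right : ∀ r → T (opens R (lookup (ladderShape 0 r) 1F))
ladder-first-right zero    = tt
ladder-first-right (suc _) = tt

ladder-lower-down : ∀ d r j → j ≢ 0F → T (opens D (lookup (ladderShape (suc d) r) j))
ladder-lower-down d r       0F j≢0 = contradiction refl j≢0
ladder-lower-down d zero    1F _   = tt
ladder-lower-down d (suc _) 1F _   = tt
ladder-lower-down d zero    2F _   = tt
ladder-lower-down d (suc _) 2F _   = tt

ladder-last-no-up : ∀ d j → j ≢ 0F → ¬ T (opens U (lookup (ladderShape d 0) j))
ladder-last-no-up d 0F j≢0 = contradiction refl j≢0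
ladder-last-no-up d 1F _   ()
ladder-last-no-up d 2F _   ()

module _ (M′ : ℕ) where

  ladderHeight : ℕ → ℕ
  ladderHeight zero    = 1
  ladderHeight (suc _) = suc M′

  open BlockFactor {3 + M′} (s≤s (s≤s z≤n)) ladderHeight 1 refl ladderShape ladder-consistent
                   ladder-within (λ _ → refl) refl

  ladder-separable : (A : Fin 3 → Torus (3 + M′) 2) →
                     proj₂ (A 2F) ≡ 0F → proj₂ (A 0F) ≢ 0F → proj₂ (A 1F) ≢ 0F →
                     toℕ (proj₁ (A 0F)) < 2 → 2 ≤ toℕ (proj₁ (A 1F)) → Separable 0 A
  ladder-separable A pipe₂ off₀ off₁ low₀ high₁ =
    factor ,
    separates-by-classes factor class (invariant class up-invariant right-invariant) root reach cover distinct
    where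
    class : Torus (3 + M′) 2 → ℕ
    class (i , 0F)    = 2
    class (i , suc _) = block (placeOf i)

    class-pipe : ∀ i j → j ≡ 0F → class (i , j) ≡ 2
    class-pipe i 0F refl = refl

    class-off : ∀ i j → j ≢ 0F → class (i , j) ≡ block (placeOf i)
    class-off i 0F      j≢0 = contradiction refl j≢0
    class-off i (suc _) _   = refl

    up-invariant : ∀ v → Opens U v → class (move U v) ≡ class v
    up-invariant (i , 0F)    o = refl
    up-invariant (i , suc j) o = block-up i λ r≡0 →
      ladder-last-no-up d (suc j) (λ ()) (subst (λ r → T (opens U (lookup (ladderShape d r) (suc j)))) r≡0 o)
      where d = depth (placeOf i)

    right-invariant : ∀ v → Opens R v → class (move R v) ≡ class v
    right-invariant (i , 0F) o =
      contradiction (subst (T ∘ opens R) (ladder-pipe (depth (placeOf i)) (rest (placeOf i))) o) λ ()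
    right-invariant (i , 1F) o = refl
    right-invariant (i , 2F) o = contradiction o (ladder-no-right (depth (placeOf i)) (rest (placeOf i)))

    root : ℕ → Torus (3 + M′) 2
    root zero          = 0F , 1F
    root (suc zero)    = 2F , 1F
    root (suc (suc _)) = 0F , 0F

    block≤1 : ∀ i → block (placeOf i) ≤ 1
    block≤1 i = block-bounded 1 (toℕ i) (≤-pred (toℕ<n i))

    first-row-root : ∀ {i k r} → k ≤ 1 → placeOf i ≡ place k 0 r → root k ≡ (i , 1F)
    first-row-root {i} z≤n       eq = cong (_, 1F) (toℕ-injective (sym (first-row i eq)))
    first-row-root {i} (s≤s z≤n) eq = cong (_, 1F) (toℕ-injective (sym (first-row i eq)))

    reach : ∀ v → Star F (root (class v)) v
    reach (i , 0F)    = pipe-reach 0F pipe-down i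
      where
      pipe-down : ∀ i → Opens D (i , 0F)
      pipe-down i = subst (T ∘ opens D) (sym (ladder-pipe (depth (placeOf i)) (rest (placeOf i)))) tt
    reach (i , suc j) = reach-block (_≢ 0F) k (root k) first lower (λ ()) refl
      where
      k = block (placeOf i)
      first : ∀ {i′ j′ r} → j′ ≢ 0F → placeOf i′ ≡ place k 0 r → Star F (root k) (i′ , j′)
      first {i′} {0F}     j′≢0 eq = contradiction refl j′≢0
      first {i′} {1F}     _    eq = subst (λ v → Star F v (i′ , 1F)) (sym (first-row-root (block≤1 i) eq)) ε
      first {i′} {2F} {r} _    eq = subst (λ v → Star F v (i′ , 2F)) (sym (first-row-root (block≤1 i) eq))
        (along R (i′ , 1F) (opens-at {i′} eq R 1F (ladder-first-right r)) ◅ ε)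
      lower : ∀ {i′ j′ d r} → j′ ≢ 0F → placeOf i′ ≡ place k (suc d) r →
              ∃[ j″ ] (j″ ≢ 0F × Star F (cpred i′ , j″) (i′ , j′))
      lower {i′} {j′} {d} {r} j′≢0 eq =
        j′ , j′≢0 , back D (i′ , j′) (opens-at {i′} eq D j′ (ladder-lower-down d r j′ j′≢0))

    low-block : ∀ i → toℕ i < 2 → block (placeOf i) ≡ 0
    low-block i i<2 with toℕ i | i<2
    ... | zero        | _            = refl
    ... | suc zero    | _            = refl
    ... | suc (suc _) | s≤s (s≤s ())

    high-block : ∀ i → 2 ≤ toℕ i → block (placeOf i) ≡ 1
    high-block i 2≤i with m≤n⇒∃[o]m+o≡n 2≤i
    ... | d , 2+d≡i =
      cong block (trans (cong locate (sym 2+d≡i)) (locate-start 1 d (suc M′ ∸ d) (m+[n∸m]≡n d≤)))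
      where
      d≤ : d ≤ suc M′
      d≤ = +-cancelˡ-≤ 2 d (suc M′) (subst (_≤ 3 + M′) (sym 2+d≡i) (≤-pred (toℕ<n i)))

    class-A : ∀ i → class (A i) ≡ toℕ i
    class-A 0F = trans (class-off _ _ off₀) (low-block _ low₀)
    class-A 1F = trans (class-off _ _ off₁) (high-block _ high₁)
    class-A 2F = class-pipe _ _ pipe₂

    cover : ∀ v → ∃[ i ] class (A i) ≡ class v
    cover (i , 0F)    = 2F , class-A 2F
    cover (i , suc _) with block (placeOf i) | block≤1 i
    ... | zero        | _      = 0F , class-A 0F
    ... | suc zero    | _      = 1F , class-A 1F
    ... | suc (suc _) | s≤s ()

    distinct : Injective _≡_ _≡_ (class ∘ A)
    distinct {i} {i′} eq = toℕ-injective (trans (sym (class-A i)) (trans eq (class-A i′)))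

-- Sufficiency

module _ (M′ : ℕ) where

  private
    V : Set
    V = Torus (3 + M′) 2

    row : V → Fin (4 + M′)
    row = proj₁

    col : V → Fin 3
    col = proj₂

    2≤M : 2 ≤ 3 + M′
    2≤M = s≤s (s≤s z≤n)

  bands-sorted : (A : Fin 3 → V) → row (A 0F) ≡ 0F →
                 0 < toℕ (row (A 1F)) → toℕ (row (A 1F)) < toℕ (row (A 2F)) → Separable 0 A
  bands-sorted A r₀≡0 0<r₁ r₁<r₂ with toℕ (row (A 1F)) in r₁≡ | 0<r₁
  ... | suc a | _ with m≤n⇒∃[o]m+o≡n r₁<r₂ | m≤n⇒∃[o]m+o≡n (≤-pred (toℕ<n (row (A 2F))))
  ... | b , r₂≡ | c , M≡ = bands-separable 2≤M a b c (trans (sym M≡) (cong (_+ c) r₂≡′)) A rows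
    where
    r₂≡′ : toℕ (row (A 2F)) ≡ suc a + suc b
    r₂≡′ = trans (sym r₂≡) (cong suc (sym (+-suc a b)))
    rows : ∀ i → toℕ (row (A i)) ≡ Layout.start (bandHeight a b c) (toℕ i)
    rows 0F = cong toℕ r₀≡0
    rows 1F = r₁≡
    rows 2F = r₂≡′

  bands : (A : Fin 3 → V) → row (A 0F) ≢ row (A 1F) → row (A 0F) ≢ row (A 2F) →
          row (A 1F) ≢ row (A 2F) → Separable 0 A
  bands A r₀≢r₁ r₀≢r₂ r₁≢r₂ = separable-shift t 0 sorted
    where
    t = toℕ (row (A 0F))
    B = shift t 0 ∘ A
    B₀≡0 : row (B 0F) ≡ 0F
    B₀≡0 = iterate-cpred-toℕ (row (A 0F))
    apart : ∀ {i j} → row (A i) ≢ row (A j) → row (B i) ≢ row (B j)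
    apart r≢ = r≢ ∘ iterate-injective cpred-injective t
    positive : ∀ {i} → row (A 0F) ≢ row (A i) → 0 < toℕ (row (B i))
    positive r≢ = nonzero-toℕ (λ Bᵢ≡0 → apart r≢ (trans B₀≡0 (sym Bᵢ≡0)))
    sorted : Separable 0 B
    sorted with <-cmp (toℕ (row (B 1F))) (toℕ (row (B 2F)))
    ... | tri< r₁<r₂ _ _ = bands-sorted B B₀≡0 (positive r₀≢r₁) r₁<r₂
    ... | tri≈ _ r₁≡r₂ _ = contradiction (toℕ-injective r₁≡r₂) (apart r₁≢r₂)
    ... | tri> _ _ r₂<r₁ =
      separable-permute (transpose 1F 2F) (bands-sorted _ B₀≡0 (positive r₀≢r₂) r₂<r₁)

  corner-normal : (A : Fin 3 → V) → col (A 2F) ≡ 0F → col (A 0F) ≢ 0F → col (A 1F) ≢ 0F →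
                  row (A 0F) ≡ 0F → row (A 1F) ≢ 0F → Separable 0 A
  corner-normal A c₂≡0 c₀≢0 c₁≢0 r₀≡0 r₁≢0 with row (A 1F) in r₁≡
  ... | 0F          = contradiction refl r₁≢0
  ... | suc (suc _) = ladder-separable M′ A c₂≡0 c₀≢0 c₁≢0 low high
    where
    low : toℕ (row (A 0F)) < 2
    low = subst (λ i → toℕ i < 2) (sym r₀≡0) (s≤s z≤n)
    high : 2 ≤ toℕ (row (A 1F))
    high = subst (λ i → 2 ≤ toℕ i) (sym r₁≡) (s≤s (s≤s z≤n))
  -- A 1F lies in row 1: one more rotation moves it to row 0 and A 0F to the last row.
  ... | 1F          =
    separable-shift 1 0
      (separable-permute (transpose 0F 1F) (ladder-separable M′ _ c₂≡0 c₁≢0 c₀≢0 low high))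
    where
    low : toℕ (cpred (row (A 1F))) < 2
    low = subst (λ i → toℕ (cpred i) < 2) (sym r₁≡) (s≤s z≤n)
    high : 2 ≤ toℕ (cpred (row (A 0F)))
    high = subst (λ i → 2 ≤ toℕ (cpred i)) (sym r₀≡0)
                 (subst (2 ≤_) (sym (toℕ-fromℕ _)) (s≤s (s≤s z≤n)))

  corner : (A : Fin 3 → V) → Injective _≡_ _≡_ A →
           col (A 0F) ≡ col (A 1F) → row (A 2F) ≡ row (A 0F) → Separable 0 A
  corner A inj c₀≡c₁ r₂≡r₀ = separable-shift t₁ t₂ (corner-normal B c₂≡0 c₀≢0 c₁≢0 r₀≡0 r₁≢0)
    where
    t₁ = toℕ (row (A 0F))
    t₂ = toℕ (col (A 2F))
    B = shift t₁ t₂ ∘ A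
    c₂≡0 : col (B 2F) ≡ 0F
    c₂≡0 = iterate-cpred-toℕ (col (A 2F))
    r₀≡0 : row (B 0F) ≡ 0F
    r₀≡0 = iterate-cpred-toℕ (row (A 0F))
    c₀≢0 : col (B 0F) ≢ 0F
    c₀≢0 c₀≡0
      with inj (cong₂ _,_ (sym r₂≡r₀) (iterate-injective cpred-injective t₂ (trans c₀≡0 (sym c₂≡0))))
    ... | ()
    c₁≢0 : col (B 1F) ≢ 0F
    c₁≢0 = subst (_≢ 0F) (cong (λ j → iterate cpred j t₂) c₀≡c₁) c₀≢0
    r₁≢0 : row (B 1F) ≢ 0F
    r₁≢0 r₁≡0
      with inj (cong₂ _,_ (iterate-injective cpred-injective t₁ (trans r₀≡0 (sym r₁≡0))) c₀≡c₁)
    ... | ()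

  sharing-column : (A : Fin 3 → V) → Injective _≡_ _≡_ A → col (A 0F) ≡ col (A 1F) → Separable 0 A
  sharing-column A inj c₀≡c₁ with row (A 2F) ≟ᶠ row (A 0F) | row (A 2F) ≟ᶠ row (A 1F)
  ... | yes r₂≡r₀ | _         = corner A inj c₀≡c₁ r₂≡r₀
  ... | no _      | yes r₂≡r₁ =
    separable-permute π (corner _ (permute-injective π inj) (sym c₀≡c₁) r₂≡r₁)
    where π = transpose 0F 1F
  ... | no r₂≢r₀  | no r₂≢r₁  = bands A r₀≢r₁ (r₂≢r₀ ∘ sym) (r₂≢r₁ ∘ sym)
    where
    r₀≢r₁ : row (A 0F) ≢ row (A 1F)
    r₀≢r₁ r₀≡r₁ with inj (cong₂ _,_ r₀≡r₁ c₀≡c₁)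
    ... | ()

  sufficiency : SpanningCyclable 3 (4 + M′) 0 3
  sufficiency A inj with col (A 0F) ≟ᶠ col (A 1F) | col (A 0F) ≟ᶠ col (A 2F) | col (A 1F) ≟ᶠ col (A 2F)
  ... | yes c₀≡c₁ | _         | _         = sharing-column A inj c₀≡c₁
  ... | no _      | yes c₀≡c₂ | _         =
    separable-permute π (sharing-column _ (permute-injective π inj) c₀≡c₂)
    where π = transpose 1F 2F
  ... | no _      | no _      | yes c₁≡c₂ =
    separable-permute π (sharing-column _ (permute-injective π inj) (sym c₁≡c₂))
    where π = transpose 0F 2F
  ... | no c₀≢c₁  | no c₀≢c₂  | no c₁≢c₂  =
    columns-separable 2≤M (s≤s (s≤s z≤n)) A (injective₃ c₀≢c₁ c₀≢c₂ c₁≢c₂)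

-- Necessity

%-absorbˡ : ∀ x y → (x % suc n + y) % suc n ≡ (x + y) % suc n
%-absorbˡ {n} x y = begin
  (x % suc n + y) % suc n                  ≡⟨ %-distribˡ-+ (x % suc n) y (suc n) ⟩
  (x % suc n % suc n + y % suc n) % suc n  ≡⟨ cong (λ z → (z + y % suc n) % suc n) (m%n%n≡m%n x (suc n)) ⟩
  (x % suc n + y % suc n) % suc n          ≡⟨ sym (%-distribˡ-+ x y (suc n)) ⟩
  (x + y) % suc n                          ∎
  where open ≡-Reasoning

toℕ-iterate-csuc : ∀ (j : Fin (suc n)) ℓ → toℕ (iterate csuc j ℓ) ≡ (toℕ j + ℓ) % suc n
toℕ-iterate-csuc {n} j zero    =
  sym (trans (cong (_% suc n) (+-identityʳ (toℕ j))) (m<n⇒m%n≡m (toℕ<n j)))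
toℕ-iterate-csuc {n} j (suc ℓ) = begin
  toℕ (iterate csuc (csuc j) ℓ)     ≡⟨ toℕ-iterate-csuc (csuc j) ℓ ⟩
  (toℕ (csuc j) + ℓ) % suc n        ≡⟨ cong (λ x → (x + ℓ) % suc n) (toℕ-csuc j) ⟩
  (suc (toℕ j) % suc n + ℓ) % suc n ≡⟨ %-absorbˡ {n} (suc (toℕ j)) ℓ ⟩
  (suc (toℕ j) + ℓ) % suc n         ≡⟨ cong (_% suc n) (sym (+-suc (toℕ j) ℓ)) ⟩
  (toℕ j + suc ℓ) % suc n           ∎
  where open ≡-Reasoning

wrap-injective : ∀ ℓ {i j : Fin (suc n)} → (toℕ i + ℓ) % suc n ≡ (toℕ j + ℓ) % suc n → i ≡ j
wrap-injective ℓ {i} {j} eq = iterate-injective csuc-injective ℓ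
  (toℕ-injective (trans (toℕ-iterate-csuc i ℓ) (trans eq (sym (toℕ-iterate-csuc j ℓ)))))

module _ {m ℓ N : ℕ} where

  Horizontal : {x y : Vertex m (suc N)} → Edge m ℓ (suc N) x y → Set
  Horizontal (horiz _ _ _ _) = ⊤
  Horizontal _               = ⊥

  Rising : Vertex m (suc N) → Vertex m (suc N) → Set
  Rising x y = Σ (Edge m ℓ (suc N) x y) (¬_ ∘ Horizontal)

  rising-into-unique : ∀ {x y v} → Rising x v → Rising y v → x ≡ y
  rising-into-unique (horiz _ _ _ _ , ¬h) _ = ⊥-elim (¬h tt)
  rising-into-unique _ (horiz _ _ _ _ , ¬h) = ⊥-elim (¬h tt)
  rising-into-unique (vert i i′ j p , _) (vert _ .i′ .j q , _) =
    cong (_, j) (toℕ-injective (suc-injective (trans (sym p) q)))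
  rising-into-unique (vert _ i′ _ p , _) (wrap _ .i′ _ _ _ q _ , _) =
    contradiction (trans (sym p) q) λ ()
  rising-into-unique (wrap _ i′ _ _ _ q _ , _) (vert _ .i′ _ p , _) =
    contradiction (trans (sym p) q) λ ()
  rising-into-unique (wrap _ i′ _ j′ p _ r , _) (wrap _ .i′ _ .j′ p₂ _ r₂ , _) =
    cong₂ _,_ (toℕ-injective (suc-injective (trans p (sym p₂)))) (wrap-injective ℓ (trans (sym r) r₂))

module _ {M ℓ N : ℕ} (1≤N : 1 ≤ N) (T : TwoFactor (suc M) ℓ (suc N))
         (sep : Separates (suc N) T (λ j → 0F , j)) where

  open TwoFactor T

  private
    same-cycle : ∀ {j j′ v w} → Star F (0F , j) v → Star F (0F , j′) w → F v w → j ≡ j′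
    same-cycle p q f = proj₂ sep _ _ (p ◅◅ (f ◅ reverse F-sym q))

    Climbed : Fin (suc M) → Set
    Climbed i = ∀ j → Star F (0F , j) (i , j)

    -- In a climbed row a horizontal edge would join two cycles.
    kind : ∀ {i} → Climbed i → ∀ {j w} → F (i , j) w → Rising (i , j) w ⊎ Rising w (i , j)
    kind climbed {j} f with F-sub f
    ... | inj₁ (horiz _ _ j′ p) =
      ⊥-elim (csuc≢id 1≤N j (trans (sym (toℕ-injective (trans p (sym (toℕ-csuc j)))))
                                   (sym (same-cycle (climbed j) (climbed j′) f))))
    ... | inj₂ (horiz _ j′ _ p) =
      ⊥-elim (csuc≢id 1≤N j′ (trans (sym (toℕ-injective (trans p (sym (toℕ-csuc j′)))))
                                    (same-cycle (climbed j) (climbed j′) f)))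
    ... | inj₁ e@(vert _ _ _ _)       = inj₁ (e , λ ())
    ... | inj₁ e@(wrap _ _ _ _ _ _ _) = inj₁ (e , λ ())
    ... | inj₂ e@(vert _ _ _ _)       = inj₂ (e , λ ())
    ... | inj₂ e@(wrap _ _ _ _ _ _ _) = inj₂ (e , λ ())

    rises : ∀ {i} → Climbed i → ∀ j → ∃[ w ] (F (i , j) w × Rising (i , j) w)
    rises climbed j with deg2 (_ , j)
    ... | x , y , x≢y , fx , fy , _ with kind climbed fx | kind climbed fy
    ...   | inj₁ r  | _       = x , fx , r
    ...   | inj₂ _  | inj₁ r  = y , fy , r
    ...   | inj₂ rx | inj₂ ry = ⊥-elim (x≢y (rising-into-unique rx ry))

    climbed : ∀ t (i : Fin (suc M)) → toℕ i ≡ t → Climbed i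
    climbed zero    0F      _  j = ε
    climbed (suc t) (suc i) eq j with climbed t (inject₁ i) (trans (toℕ-inject₁ i) (suc-injective eq))
    ... | below with rises below j
    ...   | _ , f , (vert _ i′ _ p , _) =
      subst (λ i″ → Star F (0F , j) (i″ , j)) (toℕ-injective (trans p (cong suc (toℕ-inject₁ i))))
            (below j ◅◅ (f ◅ ε))
    ...   | _ , _ , (wrap _ _ _ _ p _ _ , _) =
      ⊥-elim (<-irrefl (trans (sym (toℕ-inject₁ i)) (suc-injective p)) (toℕ<n i))
    ...   | _ , _ , (horiz _ _ _ _ , ¬h) = ⊥-elim (¬h tt)

  row-zero-separated⇒ℓ%n≡0 : ℓ % suc N ≡ 0
  row-zero-separated⇒ℓ%n≡0 with rises (climbed M (fromℕ M) (toℕ-fromℕ M)) 0F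
  ... | _ , _ , (vert _ i′ _ p , _) =
    contradiction (subst (_< suc M) (trans p (cong suc (toℕ-fromℕ M))) (toℕ<n i′)) (<-irrefl refl)
  ... | _ , f , (wrap _ i′ _ j′ _ i′≡0 j′≡ , _) =
    trans (sym j′≡) (cong toℕ (sym (same-cycle (climbed M (fromℕ M) (toℕ-fromℕ M) 0F) i′-cycle f)))
    where
    i′-cycle : Star F (0F , j′) (i′ , j′)
    i′-cycle = subst (λ i″ → Star F (0F , j′) (i″ , j′)) (sym (toℕ-injective {j = 0F} i′≡0)) ε
  ... | _ , _ , (horiz _ _ _ _ , ¬h) = ⊥-elim (¬h tt)

corners : Fin 3 → Vertex 3 3
corners 0F = 0F , 0F
corners 1F = 0F , 1F
corners 2F = 1F , 0F

module _ (T : TwoFactor 3 0 3) (sep : Separates 3 T corners) where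

  open TwoFactor T

  private
    apart : ∀ {i i′ v w} → Star F (corners i) v → Star F (corners i′) w → F v w → i ≡ i′
    apart p q f = proj₂ sep _ _ (p ◅◅ (f ◅ reverse F-sym q))

    both : ∀ v {a b} → (∀ d → F v (move d v) → move d v ≡ a ⊎ move d v ≡ b) → F v a × F v b
    both v only with deg2 v
    ... | x , y , x≢y , fx , fy , _ with adj⇒move (F-sub fx) | adj⇒move (F-sub fy)
    ...   | d , refl | d′ , refl with only d fx | only d′ fy
    ...     | inj₁ x≡a | inj₁ y≡a = ⊥-elim (x≢y (trans x≡a (sym y≡a)))
    ...     | inj₁ x≡a | inj₂ y≡b = subst (F v) x≡a fx , subst (F v) y≡b fy
    ...     | inj₂ x≡b | inj₁ y≡a = subst (F v) y≡a fy , subst (F v) x≡b fx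
    ...     | inj₂ x≡b | inj₂ y≡b = ⊥-elim (x≢y (trans x≡b (sym y≡b)))

    single : ∀ v {a} → (∀ d → F v (move d v) → move d v ≡ a) → ⊥
    single v only with deg2 v
    ... | x , y , x≢y , fx , fy , _ with adj⇒move (F-sub fx) | adj⇒move (F-sub fy)
    ...   | d , refl | d′ , refl = x≢y (trans (only d fx) (sym (only d′ fy)))

  corners-inseparable : ⊥
  corners-inseparable = single (0F , 1F) at-corner₁
    where
    at-corner₀ : F (0F , 0F) (2F , 0F) × F (0F , 0F) (0F , 2F)
    at-corner₀ = both (0F , 0F) λ
      { U f → contradiction (apart {0F} {2F} ε ε f) λ ()
      ; D f → inj₁ refl
      ; L f → inj₂ refl
      ; R f → contradiction (apart {0F} {1F} ε ε f) λ () }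
    at-corner₂ : F (1F , 0F) (1F , 1F) × F (1F , 0F) (1F , 2F)
    at-corner₂ = both (1F , 0F) λ
      { U f → contradiction (apart {2F} {0F} ε (proj₁ at-corner₀ ◅ ε) f) λ ()
      ; D f → contradiction (apart {2F} {0F} ε ε f) λ ()
      ; L f → inj₂ refl
      ; R f → inj₁ refl }
    at-corner₁ : ∀ d → F (0F , 1F) (move d (0F , 1F)) → move d (0F , 1F) ≡ (2F , 1F)
    at-corner₁ U f = contradiction (apart {1F} {2F} ε (proj₁ at-corner₂ ◅ ε) f) λ ()
    at-corner₁ D f = refl
    at-corner₁ L f = contradiction (apart {1F} {0F} ε ε f) λ ()
    at-corner₁ R f = contradiction (apart {1F} {0F} ε (proj₂ at-corner₀ ◅ ε) f) λ ()

necessity : ∀ m ℓ → 3 ≤ m → ℓ ≤ 2 → SpanningCyclable 3 m ℓ 3 → 4 ≤ m × ℓ ≡ 0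
necessity (suc M) (suc ℓ) _ ℓ≤2 S with S (λ j → 0F , j) (cong proj₂)
... | T , sep = contradiction (row-zero-separated⇒ℓ%n≡0 (s≤s z≤n) T sep) (nonzero-mod ℓ≤2)
  where
  nonzero-mod : ∀ {ℓ} → suc ℓ ≤ 2 → suc ℓ % 3 ≢ 0
  nonzero-mod (s≤s z≤n)       ()
  nonzero-mod (s≤s (s≤s z≤n)) ()
necessity 3 zero _ _ S with S corners (injective₃ (λ ()) (λ ()) (λ ()))
... | T , sep = ⊥-elim (corners-inseparable T sep)
necessity (suc (suc (suc (suc _)))) zero _ _ _ = s≤s (s≤s (s≤s (s≤s z≤n))) , refl
necessity 1 zero (s≤s ()) _ _
necessity 2 zero (s≤s (s≤s ())) _ _

lemma3p6 : ∀ (m ℓ : ℕ) → 3 ≤ m → ℓ ≤ 2 →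
           (SpanningCyclable 3 m ℓ 3 ⇔ (4 ≤ m × ℓ ≡ 0))
lemma3p6 m ℓ 3≤m ℓ≤2 = mk⇔ (necessity m ℓ 3≤m ℓ≤2) (sufficient m ℓ)
  where
  sufficient : ∀ m ℓ → 4 ≤ m × ℓ ≡ 0 → SpanningCyclable 3 m ℓ 3
  sufficient (suc (suc (suc (suc M′)))) zero (s≤s (s≤s (s≤s (s≤s _))) , refl) = sufficiency M′
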